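{- For $n \in \mathbb{N}$ let $\rho_n := \prod_{p \text{ prime}} p^{\lfloor n/p \rfloor}$ and $\sigma_n := \prod_{p \text{ prime}} p^{\lfloor n/(p-1) \rfloor}$, and let $\theta(x) := \sum_{p \text{ prime},\, p \le x} \log p$ for $x \ge 0$. Then for every positive integer $n$, $$\log \rho_n = \sum_{k=1}^{n} \theta\!\left(\frac{n}{k}\right), \qquad \log \sigma_n = \sum_{k=1}^{n} \theta\!\left(\frac{n}{k} + 1\right),$$ $$\log \sigma_n - \log \rho_n = \sum_{\substack{1 \le k \le n \\ \lfloor n/k + 1 \rfloor \text{ is prime}}} \log \left\lfloor \frac{n}{k} + 1 \right\rfloor.$$
   Context: $\log$ is the natural logarithm; $\lfloor\cdot\rfloor$ is the floor function. -}

module Defs where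

open import Data.Nat using (ℕ; zero; suc; _+_; _*_; _^_; _/_)
open import Data.Nat.Primality using (prime?)
open import Relation.Nullary using (yes; no)

prod1to : ℕ → (ℕ → ℕ) → ℕ
prod1to zero    f = 1
prod1to (suc m) f = prod1to m f * f (suc m)

-- ∏_{k=1}^{m} f k, with f taking i = k - 1 (so k = suc i)
prodK : ℕ → (ℕ → ℕ) → ℕ
prodK zero    f = 1
prodK (suc m) f = prodK m f * f m

-- p if p is prime, 1 otherwise (so exp of "log p if p prime, else 0")
primeOr1 : ℕ → ℕ
primeOr1 p with prime? p
... | yes _ = p
... | no  _ = 1

-- exp θ(x) for ⌊x⌋ = m :  ∏_{p prime, p ≤ m} p
expθ : ℕ → ℕ
expθ m = prod1to m primeOr1

ρfactor : ℕ → ℕ → ℕ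
ρfactor n zero = 1
ρfactor n (suc q) with prime? (suc q)
... | yes _ = suc q ^ (n / suc q)
... | no  _ = 1

σfactor : ℕ → ℕ → ℕ
σfactor n zero = 1
σfactor n (suc zero) = 1
σfactor n (suc (suc q)) with prime? (suc (suc q))
... | yes _ = suc (suc q) ^ (n / suc q)
... | no  _ = 1

-- ρ_n = ∏_{p prime} p^{⌊n/p⌋}; factors with p > n are 1
ρ : ℕ → ℕ
ρ n = prod1to n (ρfactor n)

-- σ_n = ∏_{p prime} p^{⌊n/(p-1)⌋}; factors with p > n+1 are 1
σ : ℕ → ℕ
σ n = prod1to (suc n) (σfactor n)

module Submission where

-- Writing exp θ(n/k) as the product of the primes p ≤ ⌊n/k⌋ and exchanging the two products,
-- each prime p occurs with exponent #{k ≤ n : p ≤ ⌊n/k⌋} = #{k ≤ n : k ≤ ⌊n/p⌋} = ⌊n/p⌋,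
-- which is ρ_n. For σ_n the condition p ≤ ⌊n/k⌋ + 1 is p − 1 ≤ ⌊n/k⌋, giving ⌊n/(p−1)⌋.
-- The third identity is θ(m + 1) = θ(m) + [m + 1 prime] log(m + 1) summed over k.

open import Defs
open import Data.Bool using (if_then_else_)
open import Data.Nat using (ℕ; zero; suc; _+_; _*_; _^_; _/_; _≤_; _⊓_; s≤s; NonZero)
open import Data.Nat.Properties
open import Data.Nat.DivMod using (m/n*n≤m; m*n/n≡m; /-monoˡ-≤; m/n≤m)
open import Data.Nat.Primality using (prime?)
open import Data.Product using (_×_; _,_)
open import Level using (Level)
open import Relation.Nullary using (yes; no; does; contradiction)
open import Relation.Nullary.Decidable using (dec-true; dec-false)
open import Relation.Unary using (Pred; Decidable; _≐_)
open import Relation.Binary.PropositionalEquality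

private
  variable
    ℓ ℓ′ : Level

prod1to-cong : ∀ M {f g : ℕ → ℕ} → (∀ p → f p ≡ g p) → prod1to M f ≡ prod1to M g
prod1to-cong zero    f≗g = refl
prod1to-cong (suc M) f≗g = cong₂ _*_ (prod1to-cong M f≗g) (f≗g (suc M))

prodK-cong : ∀ m {f g : ℕ → ℕ} → (∀ i → f i ≡ g i) → prodK m f ≡ prodK m g
prodK-cong zero    f≗g = refl
prodK-cong (suc m) f≗g = cong₂ _*_ (prodK-cong m f≗g) (f≗g m)

prod1to-1 : ∀ M → prod1to M (λ _ → 1) ≡ 1
prod1to-1 zero    = refl
prod1to-1 (suc M) = trans (*-identityʳ _) (prod1to-1 M)

prod1to-distrib-* : ∀ M f g → prod1to M (λ p → f p * g p) ≡ prod1to M f * prod1to M g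
prod1to-distrib-* zero    f g = refl
prod1to-distrib-* (suc M) f g =
  trans (cong (_* (f (suc M) * g (suc M))) (prod1to-distrib-* M f g))
        ([m*n]*[o*p]≡[m*o]*[n*p] (prod1to M f) (prod1to M g) (f (suc M)) (g (suc M)))

prodK-distrib-* : ∀ m f g → prodK m (λ i → f i * g i) ≡ prodK m f * prodK m g
prodK-distrib-* zero    f g = refl
prodK-distrib-* (suc m) f g =
  trans (cong (_* (f m * g m)) (prodK-distrib-* m f g))
        ([m*n]*[o*p]≡[m*o]*[n*p] (prodK m f) (prodK m g) (f m) (g m))

prodK-prod1to-comm : ∀ m M (h : ℕ → ℕ → ℕ) →
  prodK m (λ i → prod1to M (h i)) ≡ prod1to M (λ p → prodK m (λ i → h i p))
prodK-prod1to-comm zero    M h = sym (prod1to-1 M)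
prodK-prod1to-comm (suc m) M h =
  trans (cong (_* prod1to M (h m)) (prodK-prod1to-comm m M h))
        (sym (prod1to-distrib-* M _ (h m)))

prod1to-truncate : ∀ M b f →
  prod1to M (λ p → if does (p ≤? b) then f p else 1) ≡ prod1to (M ⊓ b) f
prod1to-truncate zero    b f = refl
-- does (p ≤? b) computes to p ≤ᵇ b, which a plain 'with' on suc M ≤? b would not abstract.
prod1to-truncate (suc M) b f with suc M ≤? b
... | yes M<b rewrite dec-true (suc M ≤? b) M<b | m≤n⇒m⊓n≡m M<b =
  cong (_* f (suc M)) (trans (prod1to-truncate M b f) (cong (λ t → prod1to t f) (m≤n⇒m⊓n≡m (<⇒≤ M<b))))
... | no  M≮b rewrite dec-false (suc M ≤? b) M≮b =
  trans (*-identityʳ _) (trans (prod1to-truncate M b f) (cong (λ t → prod1to t f) M⊓b≡1+M⊓b))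
  where
  b≤M : b ≤ M
  b≤M = ≤-pred (≰⇒> M≮b)
  M⊓b≡1+M⊓b : M ⊓ b ≡ suc M ⊓ b
  M⊓b≡1+M⊓b = trans (m≥n⇒m⊓n≡n b≤M) (sym (m≥n⇒m⊓n≡n (m≤n⇒m≤1+n b≤M)))

countBelow : {P : Pred ℕ ℓ} → Decidable P → ℕ → ℕ
countBelow P? zero = 0
countBelow P? (suc m) with P? m
... | yes _ = suc (countBelow P? m)
... | no  _ = countBelow P? m

countBelow-cong : {P : Pred ℕ ℓ} {Q : Pred ℕ ℓ′} (P? : Decidable P) (Q? : Decidable Q) →
  P ≐ Q → ∀ m → countBelow P? m ≡ countBelow Q? m
countBelow-cong P? Q? P≐Q zero = refl
countBelow-cong P? Q? P≐Q@(P⊆Q , Q⊆P) (suc m) with P? m | Q? m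
... | yes _  | yes _  = cong suc (countBelow-cong P? Q? P≐Q m)
... | no  _  | no  _  = countBelow-cong P? Q? P≐Q m
... | yes Pm | no ¬Qm = contradiction (P⊆Q Pm) ¬Qm
... | no ¬Pm | yes Qm = contradiction (Q⊆P Qm) ¬Pm

countBelow-< : ∀ b m → countBelow (_<? b) m ≡ m ⊓ b
countBelow-< b zero = refl
countBelow-< b (suc m) with m <? b
... | yes m<b rewrite m≤n⇒m⊓n≡m m<b = cong suc (trans (countBelow-< b m) (m≤n⇒m⊓n≡m (<⇒≤ m<b)))
... | no  m≮b = trans (countBelow-< b m) m⊓b≡1+m⊓b
  where
  b≤m : b ≤ m
  b≤m = ≮⇒≥ m≮b
  m⊓b≡1+m⊓b : m ⊓ b ≡ suc m ⊓ b
  m⊓b≡1+m⊓b = trans (m≥n⇒m⊓n≡n b≤m) (sym (m≥n⇒m⊓n≡n (m≤n⇒m≤1+n b≤m)))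

prodK-if-pow : {P : Pred ℕ ℓ} (P? : Decidable P) (x : ℕ) → ∀ m →
  prodK m (λ i → if does (P? i) then x else 1) ≡ x ^ countBelow P? m
prodK-if-pow P? x zero = refl
prodK-if-pow P? x (suc m) with P? m
... | yes _ = trans (cong (_* x) (prodK-if-pow P? x m)) (*-comm _ x)
... | no  _ = trans (*-identityʳ _) (prodK-if-pow P? x m)

m≤n/o⇒m*o≤n : ∀ m n o .{{_ : NonZero o}} → m ≤ n / o → m * o ≤ n
m≤n/o⇒m*o≤n m n o m≤n/o = ≤-trans (*-monoˡ-≤ o m≤n/o) (m/n*n≤m n o)

m*o≤n⇒m≤n/o : ∀ m n o .{{_ : NonZero o}} → m * o ≤ n → m ≤ n / o
m*o≤n⇒m≤n/o m n o m*o≤n = subst (_≤ n / o) (m*n/n≡m m o) (/-monoˡ-≤ o m*o≤n)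

1+m≤n/[1+o]⇒1+o≤n/[1+m] : ∀ m n o → suc m ≤ n / suc o → suc o ≤ n / suc m
1+m≤n/[1+o]⇒1+o≤n/[1+m] m n o le =
  m*o≤n⇒m≤n/o (suc o) n (suc m) (subst (_≤ n) (*-comm (suc m) (suc o)) (m≤n/o⇒m*o≤n (suc m) n (suc o) le))

countBelow-≤-/ : ∀ n q m → countBelow (λ i → suc q ≤? n / suc i) m ≡ m ⊓ (n / suc q)
countBelow-≤-/ n q m =
  trans (countBelow-cong _ (_<? n / suc q) (1+m≤n/[1+o]⇒1+o≤n/[1+m] q n _ , 1+m≤n/[1+o]⇒1+o≤n/[1+m] _ n q) m)
        (countBelow-< (n / suc q) m)

countBelow-≤-+1 : ∀ (g : ℕ → ℕ) p m → countBelow (λ i → suc p ≤? g i + 1) m ≡ countBelow (λ i → p ≤? g i) m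
countBelow-≤-+1 g p = countBelow-cong _ _
  ((λ {i} le → ≤-pred (subst (suc p ≤_) (+-comm (g i) 1) le)) ,
   (λ {i} le → subst (suc p ≤_) (+-comm 1 (g i)) (s≤s le)))

prodK-expθ : ∀ m M (g : ℕ → ℕ) → (∀ i → g i ≤ M) →
  prodK m (λ i → expθ (g i)) ≡ prod1to M (λ p → primeOr1 p ^ countBelow (λ i → p ≤? g i) m)
prodK-expθ m M g g≤M = begin
  prodK m (λ i → expθ (g i))
    ≡⟨ prodK-cong m (λ i → sym (trans (prod1to-truncate M (g i) primeOr1)
                                      (cong (λ t → prod1to t primeOr1) (m≥n⇒m⊓n≡n (g≤M i))))) ⟩
  prodK m (λ i → prod1to M (λ p → if does (p ≤? g i) then primeOr1 p else 1))
    ≡⟨ prodK-prod1to-comm m M _ ⟩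
  prod1to M (λ p → prodK m (λ i → if does (p ≤? g i) then primeOr1 p else 1))
    ≡⟨ prod1to-cong M (λ p → prodK-if-pow (λ i → p ≤? g i) (primeOr1 p) m) ⟩
  prod1to M (λ p → primeOr1 p ^ countBelow (λ i → p ≤? g i) m)
    ∎
  where open ≡-Reasoning

ρfactor-countBelow : ∀ n p → ρfactor n p ≡ primeOr1 p ^ countBelow (λ i → p ≤? n / suc i) n
ρfactor-countBelow n zero = sym (^-zeroˡ (countBelow _ n))
ρfactor-countBelow n (suc q) with prime? (suc q)
... | yes _ = cong (suc q ^_) (sym (trans (countBelow-≤-/ n q n) (m≥n⇒m⊓n≡n (m/n≤m n (suc q)))))
... | no  _ = sym (^-zeroˡ (countBelow _ n))

σfactor-countBelow : ∀ n p → σfactor n p ≡ primeOr1 p ^ countBelow (λ i → p ≤? n / suc i + 1) n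
σfactor-countBelow n zero          = sym (^-zeroˡ (countBelow _ n))
σfactor-countBelow n (suc zero)    = sym (^-zeroˡ (countBelow _ n))
σfactor-countBelow n (suc (suc q)) with prime? (suc (suc q))
... | yes _ = cong (suc (suc q) ^_) (sym (begin
  countBelow (λ i → suc (suc q) ≤? n / suc i + 1) n ≡⟨ countBelow-≤-+1 (λ i → n / suc i) (suc q) n ⟩
  countBelow (λ i → suc q ≤? n / suc i) n            ≡⟨ countBelow-≤-/ n q n ⟩
  n ⊓ (n / suc q)                                    ≡⟨ m≥n⇒m⊓n≡n (m/n≤m n (suc q)) ⟩
  n / suc q                                          ∎))
  where open ≡-Reasoning
... | no  _ = sym (^-zeroˡ (countBelow _ n))

expθ-+1 : ∀ m → expθ (m + 1) ≡ expθ m * primeOr1 (m + 1)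
expθ-+1 m rewrite +-comm m 1 = refl

proposition5 : (n : ℕ) → 1 ≤ n →
    (ρ n ≡ prodK n (λ i → expθ (n / suc i)))
    × (σ n ≡ prodK n (λ i → expθ (n / suc i + 1)))
    × (σ n ≡ ρ n * prodK n (λ i → primeOr1 (n / suc i + 1)))
proposition5 n _ = ρ-expθ , σ-expθ , σ-ρ
  where
  open ≡-Reasoning
  ρ-expθ : ρ n ≡ prodK n (λ i → expθ (n / suc i))
  ρ-expθ = trans (prod1to-cong n (ρfactor-countBelow n))
                 (sym (prodK-expθ n n _ (λ i → m/n≤m n (suc i))))
  σ-expθ : σ n ≡ prodK n (λ i → expθ (n / suc i + 1))
  σ-expθ = trans (prod1to-cong (suc n) (σfactor-countBelow n))
                 (sym (prodK-expθ n (suc n) _ (λ i → subst (n / suc i + 1 ≤_) (+-comm n 1)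
                                                          (+-monoˡ-≤ 1 (m/n≤m n (suc i))))))
  σ-ρ : σ n ≡ ρ n * prodK n (λ i → primeOr1 (n / suc i + 1))
  σ-ρ = begin
    σ n                                                             ≡⟨ σ-expθ ⟩
    prodK n (λ i → expθ (n / suc i + 1))                            ≡⟨ prodK-cong n (λ i → expθ-+1 (n / suc i)) ⟩
    prodK n (λ i → expθ (n / suc i) * primeOr1 (n / suc i + 1))     ≡⟨ prodK-distrib-* n _ _ ⟩
    prodK n (λ i → expθ (n / suc i)) * primes                       ≡⟨ cong (_* primes) ρ-expθ ⟨
    ρ n * primes                                                    ∎
    where primes = prodK n (λ i → primeOr1 (n / suc i + 1))
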